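{- For incidence hypergraphs $G,H$, define $H^G$ by $\check V(H^G)=\mathbf{Set}(\check V(G),\check V(H))$, $\check E(H^G)=\mathbf{Set}(\check E(G),\check E(H))$, $I(H^G)=\mathfrak{R}(G,H)$, $\varsigma_{H^G}(\phi)=\check V(\phi)$, $\omega_{H^G}(\phi)=\check E(\phi)$, and define $\epsilon^G_H:G\times H^G\to H$ by $\check V(\epsilon^G_H)(v,f)=f(v)$, $\check E(\epsilon^G_H)(e,g)=g(e)$, $I(\epsilon^G_H)(i,\phi)=I(\phi)(i)$. Then for every incidence hypergraph $K$ and every morphism $\psi:G\times K\to H$ in $\mathfrak{R}$ there is a unique morphism $\hat\psi:K\to H^G$ such that $\epsilon^G_H\circ(G\times\hat\psi)=\psi$.
   Context: An incidence hypergraph $G$ consists of sets $\check V(G)$, $\check E(G)$, $I(G)$ and functions $\varsigma_G:I(G)\to\check V(G)$, $\omega_G:I(G)\to\check E(G)$; a morphism $\phi:G\to H$ is a triple of functions $(\check V(\phi),\check E(\phi),I(\phi))$ with $\varsigma_H\circ I(\phi)=\check V(\phi)\circ\varsigma_G$ and $\omega_H\circ I(\phi)=\check E(\phi)\circ\omega_G$; this is the category $\mathfrak{R}$, and $\mathfrak{R}(G,H)$ is its hom-set. The product $G\times K$ in $\mathfrak{R}$ is componentwise: vertices $\check V(G)\times\check V(K)$, edges $\check E(G)\times\check E(K)$, incidences $I(G)\times I(K)$, with $\varsigma_G\times\varsigma_K$ and $\omega_G\times\omega_K$. -}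

module Defs where

open import Level using (Level)
open import Data.Product using (_×_; _,_; proj₁; proj₂)
open import Relation.Binary.PropositionalEquality using (_≡_; refl; cong; trans)

record Hypergraph (ℓ : Level) : Set (Level.suc ℓ) where
  field
    V : Set ℓ
    E : Set ℓ
    I : Set ℓ
    ς : I → V
    ω : I → E
open Hypergraph public

record Hom {ℓ : Level} (G H : Hypergraph ℓ) : Set ℓ where
  field
    Vᵐ : V G → V H
    Eᵐ : E G → E H
    Iᵐ : I G → I H
    ς-comm : ∀ i → ς H (Iᵐ i) ≡ Vᵐ (ς G i)
    ω-comm : ∀ i → ω H (Iᵐ i) ≡ Eᵐ (ω G i)
open Hom public

_≈ₘ_ : {ℓ : Level} {G H : Hypergraph ℓ} → Hom G H → Hom G H → Set ℓ
φ ≈ₘ χ = (∀ v → Vᵐ φ v ≡ Vᵐ χ v) × (∀ e → Eᵐ φ e ≡ Eᵐ χ e) × (∀ i → Iᵐ φ i ≡ Iᵐ χ i)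

_∘ₘ_ : {ℓ : Level} {G H K : Hypergraph ℓ} → Hom H K → Hom G H → Hom G K
Vᵐ (ψ ∘ₘ φ) v = Vᵐ ψ (Vᵐ φ v)
Eᵐ (ψ ∘ₘ φ) e = Eᵐ ψ (Eᵐ φ e)
Iᵐ (ψ ∘ₘ φ) i = Iᵐ ψ (Iᵐ φ i)
ς-comm (ψ ∘ₘ φ) i = trans (ς-comm ψ (Iᵐ φ i)) (cong (Vᵐ ψ) (ς-comm φ i))
ω-comm (ψ ∘ₘ φ) i = trans (ω-comm ψ (Iᵐ φ i)) (cong (Eᵐ ψ) (ω-comm φ i))

_×ᴴ_ : {ℓ : Level} → Hypergraph ℓ → Hypergraph ℓ → Hypergraph ℓ
V (G ×ᴴ K) = V G × V K
E (G ×ᴴ K) = E G × E K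
I (G ×ᴴ K) = I G × I K
ς (G ×ᴴ K) (i , j) = ς G i , ς K j
ω (G ×ᴴ K) (i , j) = ω G i , ω K j

_×ₘ_ : {ℓ : Level} (G : Hypergraph ℓ) {K L : Hypergraph ℓ} → Hom K L → Hom (G ×ᴴ K) (G ×ᴴ L)
Vᵐ (G ×ₘ φ) (v , k) = v , Vᵐ φ k
Eᵐ (G ×ₘ φ) (e , k) = e , Eᵐ φ k
Iᵐ (G ×ₘ φ) (i , k) = i , Iᵐ φ k
ς-comm (G ×ₘ φ) (i , k) = cong (ς G i ,_) (ς-comm φ k)
ω-comm (G ×ₘ φ) (i , k) = cong (ω G i ,_) (ω-comm φ k)

Exp : {ℓ : Level} → Hypergraph ℓ → Hypergraph ℓ → Hypergraph ℓ
V (Exp H G) = V G → V H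
E (Exp H G) = E G → E H
I (Exp H G) = Hom G H
ς (Exp H G) φ = Vᵐ φ
ω (Exp H G) φ = Eᵐ φ

eval : {ℓ : Level} (G H : Hypergraph ℓ) → Hom (G ×ᴴ Exp H G) H
Vᵐ (eval G H) (v , f) = f v
Eᵐ (eval G H) (e , g) = g e
Iᵐ (eval G H) (i , φ) = Iᵐ φ i
ς-comm (eval G H) (i , φ) = ς-comm φ i
ω-comm (eval G H) (i , φ) = ω-comm φ i

_≈ᴱ_ : {ℓ : Level} {K G H : Hypergraph ℓ} → Hom K (Exp H G) → Hom K (Exp H G) → Set ℓ
φ ≈ᴱ χ = (∀ k v → Vᵐ φ k v ≡ Vᵐ χ k v) × (∀ k e → Eᵐ φ k e ≡ Eᵐ χ k e)
         × (∀ j → Iᵐ φ j ≈ₘ Iᵐ χ j)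

module Submission where

-- Write  uncurry χ = ε ∘ (G × χ)  for χ : K → H^G.  In the other direction,
-- ψ : G × K → H is curried componentwise: a vertex k of K goes to the
-- vertex map v ↦ ψ(v, k), an edge to e ↦ ψ(e, k), and an incidence j to
-- the morphism  G → H,  i ↦ ψ(i, j)  (whose vertex and edge maps are
-- those at ς j and ω j, so the incidence squares of curry ψ hold
-- definitionally).

open import Defs
open import Level using (Level)
open import Data.Product using (Σ; _×_; _,_)
open import Relation.Binary.PropositionalEquality using (refl; trans; cong-app)

module Transpose {ℓ : Level} (G H K : Hypergraph ℓ) where

  -- ≈ᴱ with its hypergraph indices fixed (they are not recoverable from Exp H G).
  infix 4 _≈_
  _≈_ : Hom K (Exp H G) → Hom K (Exp H G) → Set ℓ
  _≈_ = _≈ᴱ_ {K = K} {G = G} {H = H}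

  ≈-trans : (χ₁ χ₂ χ₃ : Hom K (Exp H G)) → χ₁ ≈ χ₂ → χ₂ ≈ χ₃ → χ₁ ≈ χ₃
  ≈-trans _ _ _ (p , q , r) (p′ , q′ , r′) =
    (λ k v → trans (p k v) (p′ k v)) , (λ k e → trans (q k e) (q′ k e)) ,
    λ j → let (a , b , c) = r j ; (a′ , b′ , c′) = r′ j in
          (λ v → trans (a v) (a′ v)) , (λ e → trans (b e) (b′ e)) , (λ i → trans (c i) (c′ i))

  curry : Hom (G ×ᴴ K) H → Hom K (Exp H G)
  Vᵐ (curry ψ) k v = Vᵐ ψ (v , k)
  Eᵐ (curry ψ) k e = Eᵐ ψ (e , k)
  Vᵐ (Iᵐ (curry ψ) j) v = Vᵐ ψ (v , ς K j)
  Eᵐ (Iᵐ (curry ψ) j) e = Eᵐ ψ (e , ω K j)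
  Iᵐ (Iᵐ (curry ψ) j) i = Iᵐ ψ (i , j)
  ς-comm (Iᵐ (curry ψ) j) i = ς-comm ψ (i , j)
  ω-comm (Iᵐ (curry ψ) j) i = ω-comm ψ (i , j)
  ς-comm (curry ψ) j = refl
  ω-comm (curry ψ) j = refl

  uncurry : Hom K (Exp H G) → Hom (G ×ᴴ K) H
  uncurry χ = eval G H ∘ₘ (G ×ₘ χ)

  uncurry-curry : (ψ : Hom (G ×ᴴ K) H) → uncurry (curry ψ) ≈ₘ ψ
  uncurry-curry ψ = (λ _ → refl) , (λ _ → refl) , (λ _ → refl)

  curry-cong : (ψ ψ′ : Hom (G ×ᴴ K) H) → ψ ≈ₘ ψ′ → curry ψ ≈ curry ψ′
  curry-cong _ _ (p , q , r) =
    (λ k v → p (v , k)) , (λ k e → q (e , k)) ,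
    λ j → (λ v → p (v , ς K j)) , (λ e → q (e , ω K j)) , (λ i → r (i , j))

  -- Every morphism into H^G is the transpose of its evaluation (η-law).
  -- At an incidence j, the vertex map of χ(j) is χ(ς j) by the incidence
  -- square of χ, and similarly for edges.
  curry-uncurry : (χ : Hom K (Exp H G)) → χ ≈ curry (uncurry χ)
  curry-uncurry χ =
    (λ _ _ → refl) , (λ _ _ → refl) ,
    λ j → (λ v → cong-app (ς-comm χ j) v) , (λ e → cong-app (ω-comm χ j) e) , (λ _ → refl)

  curry-unique : (ψ : Hom (G ×ᴴ K) H) (χ : Hom K (Exp H G)) →
                 uncurry χ ≈ₘ ψ → χ ≈ curry ψ
  curry-unique ψ χ evalχ≈ψ =
    ≈-trans χ (curry (uncurry χ)) (curry ψ)
      (curry-uncurry χ) (curry-cong (uncurry χ) ψ evalχ≈ψ)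

mainTheorem17 : {ℓ : Level} (G H K : Hypergraph ℓ) (ψ : Hom (G ×ᴴ K) H) →
    Σ (Hom K (Exp H G)) (λ ψ̂ →
      ((eval G H ∘ₘ (G ×ₘ ψ̂)) ≈ₘ ψ)
      × ((χ : Hom K (Exp H G)) → (eval G H ∘ₘ (G ×ₘ χ)) ≈ₘ ψ → χ ≈ᴱ ψ̂))
mainTheorem17 G H K ψ = curry ψ , uncurry-curry ψ , curry-unique ψ
  where open Transpose G H K
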